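{- Let $b=(b_1,\dots,b_n)$ and $a'=(a'_1,\dots,a'_n)$ be lists of nonnegative integers such that $(a',b)$ is a digraphic list, and let $a=(a_1,\dots,a_n)$ be a nonincreasing list of nonnegative integers with $a\prec a'$. Then $(a,b)$ is a digraphic list. Moreover, there is a sequence $a'=a^1,a^2,\dots,a^r=a$ such that each $a^{k+1}$ is obtained from $a^k$ by a unit transfer and every list $(a^k,b)$, $1\le k\le r$, is digraphic.
   Context: For lists $a=(a_1,\dots,a_n)$, $b=(b_1,\dots,b_n)$ of nonnegative integers, $(a,b)$ denotes the list of pairs $((a_1,b_1),\dots,(a_n,b_n))$. It is called digraphic if there exists a digraph $G$ without loops and without multiple arcs on vertices $v_1,\dots,v_n$ with indegree $d^-_G(v_i)=a_i$ and outdegree $d^+_G(v_i)=b_i$ for all $i$. Majorization: $a\prec a'$ iff $\sum_{i=1}^k a_i\le\sum_{i=1}^k a'_i$ for all $k\in\{1,\dots,n-1\}$ and $\sum_{i=1}^n a_i=\sum_{i=1}^n a'_i$ (partial sums taken in the given order, lists not re-sorted). Unit transfer: if $a'_i\ge a'_j+2$ for indices $1\le i<j\le n$, the $(i,j)$-transfer of $a'$ is the list $a'-e_i+e_j$, where $e_i$ is the $i$th unit vector. -}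

module Defs where

open import Data.Nat using (ℕ; zero; suc; _+_; _≤_; _<_; pred)
open import Data.Bool using (Bool; false)
open import Data.Fin using (Fin)
import Data.Fin as F
open import Data.Vec using (Vec; lookup; allFin; countᵇ; toList; updateAt)
open import Data.List using (take)
open import Data.Nat.ListAction using (sum)
open import Data.Product using (Σ; ∃; ∃-syntax; _×_)
open import Relation.Binary.PropositionalEquality using (_≡_)
open import Relation.Binary.Construct.Closure.ReflexiveTransitive using (Star)

-- A digraph on vertices Fin n: G u v = true iff there is an arc u → v.
-- A relation (rather than a multiset of arcs) excludes multiple arcs.
Digraph : ℕ → Set
Digraph n = Fin n → Fin n → Bool

Loopless : ∀ {n} → Digraph n → Set
Loopless {n} G = ∀ (i : Fin n) → G i i ≡ false

indeg : ∀ {n} → Digraph n → Fin n → ℕ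
indeg {n} G v = countᵇ (λ u → G u v) (allFin n)

outdeg : ∀ {n} → Digraph n → Fin n → ℕ
outdeg {n} G v = countᵇ (λ w → G v w) (allFin n)

Digraphic : ∀ {n} → Vec ℕ n → Vec ℕ n → Set
Digraphic {n} a b =
  Σ (Digraph n) λ G → Loopless G ×
    (∀ (i : Fin n) → indeg G i ≡ lookup a i × outdeg G i ≡ lookup b i)

prefixSum : ∀ {n} → ℕ → Vec ℕ n → ℕ
prefixSum k a = sum (take k (toList a))

total : ∀ {n} → Vec ℕ n → ℕ
total a = sum (toList a)

_≺_ : ∀ {n} → Vec ℕ n → Vec ℕ n → Set
_≺_ {n} a a' =
  (∀ (k : ℕ) → 1 ≤ k → k < n → prefixSum k a ≤ prefixSum k a') ×
  total a ≡ total a'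

Nonincreasing : ∀ {n} → Vec ℕ n → Set
Nonincreasing {n} a = ∀ (i j : Fin n) → i F.≤ j → lookup a j ≤ lookup a i

UnitTransfer : ∀ {n} → Vec ℕ n → Vec ℕ n → Set
UnitTransfer {n} a' c =
  ∃[ i ] ∃[ j ] (i F.< j × lookup a' j + 2 ≤ lookup a' i ×
     c ≡ updateAt (updateAt a' i pred) j suc)

TransferStep : ∀ {n} → Vec ℕ n → Vec ℕ n → Vec ℕ n → Set
TransferStep b x y = UnitTransfer x y × Digraphic y b

TransferSeq : ∀ {n} → Vec ℕ n → Vec ℕ n → Vec ℕ n → Set
TransferSeq b = Star (TransferStep b)

-- Majorisation by a′ lets one move from a′ to the nonincreasing list a by unit transfers out of
-- the first position where the two lists differ: if a′ exceeds a in its head, some later entry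
-- a′ⱼ lies below aⱼ ≤ a₁ < a′₁, and moving a unit from the head to the first such j keeps a
-- majorised. Each unit transfer (i, j) preserves realisability with the same outdegrees: since
-- a′ᵢ ≥ a′ⱼ + 2, some in-neighbour u of vᵢ is neither vⱼ nor an in-neighbour of vⱼ, and the arc
-- u → vᵢ can be redirected to u → vⱼ.
module Submission where

open import Data.Bool using (Bool; true; false; if_then_else_)
open import Data.Fin using (Fin; zero; suc)
import Data.Fin as F
import Data.Fin.Properties as FP
open import Data.Nat using (ℕ; zero; suc; _+_; _∸_; _≤_; _<_; pred; z≤n; s≤s; _≤?_; _<?_; s≤s⁻¹)
open import Data.Nat.Properties
open import Data.Nat.Tactic.RingSolver using (solve-∀)
open import Data.Product using (∃-syntax; _×_; _,_; proj₁; proj₂; map; map₂)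
open import Data.Vec using (Vec; []; _∷_; lookup; updateAt; tabulate; allFin; countᵇ)
open import Data.Vec.Properties using (lookup∘updateAt; lookup∘updateAt′)
import Data.Vec.Functional as V
import Data.Vec.Functional.Properties as VP
open import Function using (_∘_; id; const)
open import Relation.Binary.Construct.Closure.ReflexiveTransitive using (Star; ε; _◅_; _◅◅_; gmap)
open import Relation.Binary.PropositionalEquality
open import Relation.Nullary using (yes; no; contradiction)

open import Defs

-- a ⊴⟨ s ⟩ a′ : a is majorised by a′ after s extra units are put in front of a′.
_⊴⟨_⟩_ : ∀ {n} → Vec ℕ n → ℕ → Vec ℕ n → Set
a ⊴⟨ s ⟩ a′ = (∀ k → prefixSum k a ≤ s + prefixSum k a′) × total a ≡ s + total a′

_⊴_ : ∀ {n} → Vec ℕ n → Vec ℕ n → Set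
a ⊴ a′ = a ⊴⟨ 0 ⟩ a′

prefixSum-≥length : ∀ {n} k (a : Vec ℕ n) → n ≤ k → prefixSum k a ≡ total a
prefixSum-≥length zero    []      _         = refl
prefixSum-≥length (suc k) []      _         = refl
prefixSum-≥length (suc k) (x ∷ a) (s≤s n≤k) = cong (x +_) (prefixSum-≥length k a n≤k)

≺⇒⊴ : ∀ {n} {a a′ : Vec ℕ n} → a ≺ a′ → a ⊴ a′
≺⇒⊴ {n} {a} {a′} (prefix≤ , total≡) = prefix≤′ , total≡
  where
  prefix≤′ : ∀ k → prefixSum k a ≤ prefixSum k a′
  prefix≤′ zero = z≤n
  prefix≤′ (suc k) with suc k <? n
  ... | yes k<n = prefix≤ (suc k) (s≤s z≤n) k<n
  ... | no k≮n  = subst₂ _≤_ (sym (prefixSum-≥length (suc k) a (≮⇒≥ k≮n)))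
                             (sym (prefixSum-≥length (suc k) a′ (≮⇒≥ k≮n)))
                             (≤-reflexive total≡)

⊴-head-≤ : ∀ {n x y} {a a′ : Vec ℕ n} → (x ∷ a) ⊴ (y ∷ a′) → x ≤ y
⊴-head-≤ {x = x} {y} (prefix≤ , _) = subst₂ _≤_ (+-identityʳ x) (+-identityʳ y) (prefix≤ 1)

private
  +-shuffle : ∀ s e x q → s + (e + x + q) ≡ x + (s + e + q)
  +-shuffle = solve-∀

⊴-uncons : ∀ {n x s e} {a a′ : Vec ℕ n} → (x ∷ a) ⊴⟨ s ⟩ (e + x ∷ a′) → a ⊴⟨ s + e ⟩ a′
⊴-uncons {x = x} {s} {e} (prefix≤ , total≡) =
  (λ k → +-cancelˡ-≤ x _ _ (≤-trans (prefix≤ (suc k)) (≤-reflexive (+-shuffle s e x _)))) ,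
  +-cancelˡ-≡ x _ _ (trans total≡ (+-shuffle s e x _))

⊴-cons : ∀ {n x s e} {a a′ : Vec ℕ n} → a ⊴⟨ s + e ⟩ a′ → (x ∷ a) ⊴⟨ s ⟩ (e + x ∷ a′)
⊴-cons {x = x} {s} {e} {a} {a′} (prefix≤ , total≡) =
  prefix≤′ , trans (cong (x +_) total≡) (sym (+-shuffle s e x _))
  where
  prefix≤′ : ∀ k → prefixSum k (x ∷ a) ≤ s + prefixSum k (e + x ∷ a′)
  prefix≤′ zero    = z≤n
  prefix≤′ (suc k) = ≤-trans (+-monoʳ-≤ x (prefix≤ k)) (≤-reflexive (sym (+-shuffle s e x _)))

⊴-raise-head : ∀ {n d w} {a : Vec ℕ (suc n)} {a′ : Vec ℕ n} →
               a ⊴⟨ suc d ⟩ (w ∷ a′) → a ⊴⟨ d ⟩ (suc w ∷ a′)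
⊴-raise-head {d = d} {w} {a} {a′} (prefix≤ , total≡) =
  prefix≤′ , trans total≡ (sym (+-suc d _))
  where
  prefix≤′ : ∀ k → prefixSum k a ≤ d + prefixSum k (suc w ∷ a′)
  prefix≤′ zero    = z≤n
  prefix≤′ (suc k) = ≤-trans (prefix≤ (suc k)) (≤-reflexive (sym (+-suc d _)))

≤⇒∃-+ : ∀ {m n} → m ≤ n → ∃[ e ] e + m ≡ n
≤⇒∃-+ {m} {n} m≤n = n ∸ m , m∸n+n≡m m≤n

transfer-target : ∀ {m x d} (a a′ : Vec ℕ m) → (∀ j → lookup a j ≤ x) → a ⊴⟨ suc d ⟩ a′ →
                  ∃[ j ] lookup a′ j < x × a ⊴⟨ d ⟩ updateAt a′ j suc
transfer-target []      []       _     (_ , ())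
transfer-target (z ∷ a) (w ∷ a′) a≤x maj with z ≤? w
... | no z≰w = zero , <-≤-trans (≰⇒> z≰w) (a≤x zero) , ⊴-raise-head maj
... | yes z≤w with ≤⇒∃-+ z≤w
...   | e , refl =
  map suc (map₂ ⊴-cons) (transfer-target a a′ (a≤x ∘ suc) (⊴-uncons maj))

UnitTransfer-cons : ∀ {n} x {c c′ : Vec ℕ n} → UnitTransfer c c′ → UnitTransfer (x ∷ c) (x ∷ c′)
UnitTransfer-cons x (i , j , i<j , gap , refl) = suc i , suc j , s≤s i<j , gap , refl

descend-head : ∀ {m} d {x} (a a′ : Vec ℕ m) → (∀ j → lookup a j ≤ x) → a ⊴⟨ d ⟩ a′ →
               ∃[ a″ ] Star UnitTransfer (d + x ∷ a′) (x ∷ a″) × a ⊴ a″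
descend-head zero        a a′ _   maj = a′ , ε , maj
descend-head (suc d) {x} a a′ a≤x maj with transfer-target a a′ a≤x maj
... | j , a′ⱼ<x , maj′ =
  map₂ (map (step ◅_) id) (descend-head d a (updateAt a′ j suc) a≤x maj′)
  where
  step : UnitTransfer (suc d + x ∷ a′) (d + x ∷ updateAt a′ j suc)
  step = zero , suc j , s≤s z≤n ,
         subst (_≤ suc (d + x)) (+-comm 2 _) (s≤s (≤-trans a′ⱼ<x (m≤n+m x d))) , refl

transfers-to : ∀ {n} (a a′ : Vec ℕ n) → Nonincreasing a → a ⊴ a′ → Star UnitTransfer a′ a
transfers-to []      []       _  _   = ε
transfers-to (x ∷ a) (y ∷ a′) ni maj with ≤⇒∃-+ (⊴-head-≤ maj)
... | d , refl with descend-head d a a′ (λ j → ni zero (suc j) z≤n) (⊴-uncons maj)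
...   | a″ , head-steps , maj′ =
  head-steps ◅◅ gmap (x ∷_) (UnitTransfer-cons x) (transfers-to a a″ ni-tail maj′)
  where
  ni-tail : Nonincreasing a
  ni-tail i j i≤j = ni (suc i) (suc j) (s≤s i≤j)

count : ∀ {n} → (Fin n → Bool) → ℕ
count {zero}  p = 0
count {suc n} p = (if p zero then suc else id) (count (p ∘ suc))

countᵇ-tabulate : ∀ {A : Set} {n} (p : A → Bool) (g : Fin n → A) →
                  countᵇ p (tabulate g) ≡ count (p ∘ g)
countᵇ-tabulate {n = zero}  p g = refl
countᵇ-tabulate {n = suc n} p g =
  cong (if p (g zero) then suc else id) (countᵇ-tabulate p (g ∘ suc))

count-cong : ∀ {n} {p q : Fin n → Bool} → (∀ u → p u ≡ q u) → count p ≡ count q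
count-cong {zero}  p≗q = refl
count-cong {suc n} p≗q =
  cong₂ (λ b → if b then suc else id) (p≗q zero) (count-cong (p≗q ∘ suc))

count-flip : ∀ {n} {p q : Fin n → Bool} i → p i ≡ true → q i ≡ false →
             (∀ u → u ≢ i → p u ≡ q u) → count p ≡ suc (count q)
count-flip {suc n} zero pᵢ qᵢ rest rewrite pᵢ | qᵢ =
  cong suc (count-cong (λ u → rest (suc u) λ ()))
count-flip {suc n} {q = q} (suc i) pᵢ qᵢ rest
  with count-flip i pᵢ qᵢ (λ u u≢i → rest (suc u) (u≢i ∘ FP.suc-injective))
... | flipped-tail rewrite rest zero (λ ()) with q zero
...   | true  = cong suc flipped-tail
...   | false = flipped-tail

count-<⇒∃ : ∀ {n} (p q : Fin n → Bool) → count q < count p → ∃[ u ] p u ≡ true × q u ≡ false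
count-<⇒∃ {suc n} p q q<p with p zero in p₀ | q zero in q₀
... | true  | false = zero , p₀ , q₀
... | true  | true  = map suc id (count-<⇒∃ (p ∘ suc) (q ∘ suc) (s≤s⁻¹ q<p))
... | false | false = map suc id (count-<⇒∃ (p ∘ suc) (q ∘ suc) q<p)
... | false | true  = map suc id (count-<⇒∃ (p ∘ suc) (q ∘ suc) (≤-trans (n≤1+n _) q<p))

indeg-count : ∀ {n} (G : Digraph n) v → indeg G v ≡ count (λ u → G u v)
indeg-count G v = countᵇ-tabulate (λ u → G u v) id

outdeg-count : ∀ {n} (G : Digraph n) v → outdeg G v ≡ count (G v)
outdeg-count G v = countᵇ-tabulate (G v) id

-- Pigeonhole: j together with its in-neighbours number at most indeg j + 1 < indeg i.
spare-in-neighbour : ∀ {n} {G : Digraph n} {i j} → Loopless G → indeg G j + 2 ≤ indeg G i →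
                     ∃[ u ] G u i ≡ true × G u j ≡ false × u ≢ j
spare-in-neighbour {G = G} {i} {j} loopless gap
  with count-<⇒∃ (λ u → G u i) in-j-or-j (subst₂ _<_ count-in-j-or-j (indeg-count G i) gap′)
  where
  in-j-or-j : Fin _ → Bool
  in-j-or-j = V.updateAt (λ u → G u j) j (const true)
  count-in-j-or-j : suc (indeg G j) ≡ count in-j-or-j
  count-in-j-or-j = sym (trans (count-flip j (VP.updateAt-updates j _) (loopless j)
                                  (λ u u≢j → VP.updateAt-minimal u j _ u≢j))
                               (cong suc (sym (indeg-count G j))))
  gap′ : suc (indeg G j) < indeg G i
  gap′ = subst (_≤ indeg G i) (+-comm (indeg G j) 2) gap
... | u , Gui , u∉ =
  u , Gui , trans (sym (VP.updateAt-minimal u j _ u≢j)) u∉ , u≢j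
  where
  u≢j : u ≢ j
  u≢j refl = contradiction (trans (sym (VP.updateAt-updates j _)) u∉) λ ()

reroute : ∀ {n} → Digraph n → (u i j : Fin n) → Digraph n
reroute G u i j = V.updateAt G u (λ row → V.updateAt (V.updateAt row i (const false)) j (const true))

module Reroute {n} {G : Digraph n} (loopless : Loopless G) {u i j : Fin n}
               (i≢j : i ≢ j) (u≢j : u ≢ j) (Gui : G u i ≡ true) (Guj : G u j ≡ false) where

  G′ : Digraph n
  G′ = reroute G u i j

  row₀ : Fin n → Bool
  row₀ = V.updateAt (G u) i (const false)

  row-u : G′ u ≡ V.updateAt row₀ j (const true)
  row-u = VP.updateAt-updates u G

  row-other : ∀ {w} → w ≢ u → G′ w ≡ G w
  row-other w≢u = VP.updateAt-minimal _ u G w≢u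

  G′ui : G′ u i ≡ false
  G′ui = trans (cong-app row-u i)
               (trans (VP.updateAt-minimal i j row₀ i≢j) (VP.updateAt-updates i (G u)))

  G′uj : G′ u j ≡ true
  G′uj = trans (cong-app row-u j) (VP.updateAt-updates j row₀)

  G′u-other : ∀ {v} → v ≢ i → v ≢ j → G′ u v ≡ G u v
  G′u-other v≢i v≢j = trans (cong-app row-u _)
                            (trans (VP.updateAt-minimal _ j row₀ v≢j) (VP.updateAt-minimal _ i (G u) v≢i))

  u≢i : u ≢ i
  u≢i refl = contradiction (trans (sym Gui) (loopless u)) λ ()

  loopless′ : Loopless G′
  loopless′ v with v F.≟ u
  ... | yes refl = trans (G′u-other u≢i u≢j) (loopless u)
  ... | no v≢u   = trans (cong-app (row-other v≢u) v) (loopless v)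

  indeg-i : indeg G i ≡ suc (indeg G′ i)
  indeg-i = begin
    indeg G i                    ≡⟨ indeg-count G i ⟩
    count (λ w → G w i)          ≡⟨ count-flip u Gui G′ui (λ w w≢u → sym (cong-app (row-other w≢u) i)) ⟩
    suc (count (λ w → G′ w i))   ≡⟨ cong suc (sym (indeg-count G′ i)) ⟩
    suc (indeg G′ i)             ∎
    where open ≡-Reasoning

  indeg-j : indeg G′ j ≡ suc (indeg G j)
  indeg-j = begin
    indeg G′ j                   ≡⟨ indeg-count G′ j ⟩
    count (λ w → G′ w j)         ≡⟨ count-flip u G′uj Guj (λ w w≢u → cong-app (row-other w≢u) j) ⟩
    suc (count (λ w → G w j))    ≡⟨ cong suc (sym (indeg-count G j)) ⟩
    suc (indeg G j)              ∎
    where open ≡-Reasoning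

  indeg-other : ∀ {v} → v ≢ i → v ≢ j → indeg G′ v ≡ indeg G v
  indeg-other {v} v≢i v≢j =
    trans (indeg-count G′ v) (trans (count-cong column) (sym (indeg-count G v)))
    where
    column : ∀ w → G′ w v ≡ G w v
    column w with w F.≟ u
    ... | yes refl = G′u-other v≢i v≢j
    ... | no w≢u   = cong-app (row-other w≢u) v

  outdeg-reroute : ∀ w → outdeg G′ w ≡ outdeg G w
  outdeg-reroute w with w F.≟ u
  ... | no w≢u = cong (λ row → countᵇ row (allFin n)) (row-other w≢u)
  ... | yes refl = begin
    outdeg G′ u                             ≡⟨ outdeg-count G′ u ⟩
    count (G′ u)                            ≡⟨ cong count row-u ⟩
    count (V.updateAt row₀ j (const true))  ≡⟨ count-flip j (VP.updateAt-updates j row₀) row₀j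
                                                 (λ v v≢j → VP.updateAt-minimal v j row₀ v≢j) ⟩
    suc (count row₀)                        ≡⟨ sym (count-flip i Gui (VP.updateAt-updates i (G u))
                                                 (λ v v≢i → sym (VP.updateAt-minimal v i (G u) v≢i))) ⟩
    count (G u)                             ≡⟨ sym (outdeg-count G u) ⟩
    outdeg G u                              ∎
    where
    open ≡-Reasoning
    row₀j : row₀ j ≡ false
    row₀j = trans (VP.updateAt-minimal j i (G u) (i≢j ∘ sym)) Guj

  indeg-reroute : ∀ {x : Vec ℕ n} → (∀ v → indeg G v ≡ lookup x v) →
                  ∀ v → indeg G′ v ≡ lookup (updateAt (updateAt x i pred) j suc) v
  indeg-reroute {x} deg v with v F.≟ i | v F.≟ j
  ... | yes refl | _ =
    trans (cong pred (trans (sym indeg-i) (deg i)))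
          (sym (trans (lookup∘updateAt′ i j i≢j (updateAt x i pred)) (lookup∘updateAt i x)))
  ... | no v≢i | yes refl =
    trans indeg-j (trans (cong suc (deg j))
          (sym (trans (lookup∘updateAt j (updateAt x i pred)) (cong suc (lookup∘updateAt′ j i v≢i x)))))
  ... | no v≢i | no v≢j =
    trans (indeg-other v≢i v≢j) (trans (deg v)
          (sym (trans (lookup∘updateAt′ v j v≢j (updateAt x i pred)) (lookup∘updateAt′ v i v≢i x))))

UnitTransfer-preserves-Digraphic : ∀ {n} {x y b : Vec ℕ n} →
                                   UnitTransfer x y → Digraphic x b → Digraphic y b
UnitTransfer-preserves-Digraphic {x = x} (i , j , i<j , gap , refl) (G , loopless , deg) =
  let indeg≡ = proj₁ ∘ deg
      (u , Gui , Guj , u≢j) = spare-in-neighbour {G = G} {i} {j} loopless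
        (subst₂ (λ p q → p + 2 ≤ q) (sym (indeg≡ j)) (sym (indeg≡ i)) gap)
      open Reroute {G = G} loopless {u} {i} {j} (FP.<⇒≢ i<j) u≢j Gui Guj
  in G′ , loopless′ , λ v → indeg-reroute {x = x} indeg≡ v , trans (outdeg-reroute v) (proj₂ (deg v))

Star-invariant : ∀ {A : Set} {R : A → A → Set} {P : A → Set} →
                 (∀ {x y} → R x y → P x → P y) →
                 ∀ {x y} → Star R x y → P x → P y × Star (λ u v → R u v × P v) x y
Star-invariant preserves ε        px = px , ε
Star-invariant preserves (r ◅ rs) px =
  map id (_◅_ (r , preserves r px)) (Star-invariant preserves rs (preserves r px))

theorem6 : ∀ (n : ℕ) (a a' b : Vec ℕ n) →
    Digraphic a' b → Nonincreasing a → a ≺ a' →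
    Digraphic a b × TransferSeq b a' a
theorem6 n a a' b dig ni maj =
  Star-invariant (UnitTransfer-preserves-Digraphic {b = b}) (transfers-to a a' ni (≺⇒⊴ maj)) dig
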